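{- Let $(G,\tau,\Sigma,\alpha)$ be a feasible connected instance of the $t$-Dimensional Even-Cut Problem and let $k$ be its optimal value. If $\ell$ is the number of loops in $G$, then $(|V(G)|-2^t)k\le 4(|E(G)|-\ell)$.
   Context: The $t$-Dimensional Even-Cut Problem: an instance is a tuple $(G,\tau,\Sigma,\alpha)$ with $G$ a graph, $\tau:V(G)\to\mathrm{GF}(2)^t$, $\Sigma\subseteq E(G)$ and $\alpha\in\mathrm{GF}(2)^t$; the problem is to find the minimum size of a non-empty set $\delta_G(X)\triangle\Sigma'$ where $(\Sigma',\alpha')\in\{(\Sigma,\alpha),(\emptyset,0)\}$ and $X\subseteq V(G)$ satisfies $\tau(X)=\alpha'$. Here $\tau(X)=\sum_{v\in X}\tau(v)$, $\delta_G(X)$ is the set of edges with exactly one end in $X$, and $\triangle$ is symmetric difference. The instance is feasible if such a non-empty set exists, and connected if $G$ is connected; the optimal value is that minimum size. -}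

module Defs where

open import Data.Nat using (ℕ)
open import Data.Bool using (Bool; true; false; _xor_; if_then_else_)
open import Data.Fin using (Fin; _≟_)
open import Data.Fin.Subset using (Subset; ∣_∣)
open import Data.Vec using (Vec; lookup; tabulate; zipWith; replicate; foldr)
open import Data.Product using (_×_; _,_; proj₁; proj₂; ∃)
open import Data.Sum using (_⊎_)
open import Relation.Binary.PropositionalEquality using (_≡_)
open import Relation.Nullary.Decidable using (⌊_⌋)
open import Relation.Binary.Construct.Closure.ReflexiveTransitive using (Star)

-- A finite multigraph (loops and parallel edges allowed):
-- vertices Fin n, edges Fin m, each edge has an (unordered) pair of ends.
record Graph : Set where
  field
    nV   : ℕ
    nE   : ℕ
    ends : Fin nE → Fin nV × Fin nV
open Graph public

GF2^ : ℕ → Set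
GF2^ t = Vec Bool t

_⊕_ : ∀ {t} → GF2^ t → GF2^ t → GF2^ t
_⊕_ = zipWith _xor_

𝟎 : ∀ {t} → GF2^ t
𝟎 = replicate _ false

τsum : ∀ {n t} → (Fin n → GF2^ t) → Subset n → GF2^ t
τsum τ X = foldr _ _⊕_ 𝟎 (tabulate (λ v → if lookup X v then τ v else 𝟎))

δ : (G : Graph) → Subset (nV G) → Subset (nE G)
δ G X = tabulate (λ e → lookup X (proj₁ (ends G e)) xor lookup X (proj₂ (ends G e)))

_△_ : ∀ {m} → Subset m → Subset m → Subset m
_△_ = zipWith _xor_

∅ : ∀ {m} → Subset m
∅ = replicate _ false

NonEmpty : ∀ {m} → Subset m → Set
NonEmpty {m} S = ∃ λ (e : Fin m) → lookup S e ≡ true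

loops : Graph → ℕ
loops G = ∣ tabulate (λ e → ⌊ proj₁ (ends G e) ≟ proj₂ (ends G e) ⌋) ∣

Adj : (G : Graph) → Fin (nV G) → Fin (nV G) → Set
Adj G u v = ∃ λ e → (ends G e ≡ (u , v)) ⊎ (ends G e ≡ (v , u))

Connected : Graph → Set
Connected G = ∀ u v → Star (Adj G) u v

-- Instance (G, τ, Σ, α) of the t-dimensional Even-Cut Problem.
-- A "solution" is a non-empty set δ_G(X) △ Σ' with (Σ',α') ∈ {(Σ,α),(∅,0)}
-- and τ(X) = α'.
IsSolution : ∀ {t} (G : Graph) (τ : Fin (nV G) → GF2^ t) (Σ : Subset (nE G))
             (α : GF2^ t) → Subset (nE G) → Set
IsSolution G τ Σ α S =
  NonEmpty S ×
  ∃ λ (X : Subset (nV G)) →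
     ((τsum τ X ≡ α) × (S ≡ (δ G X △ Σ))) ⊎ ((τsum τ X ≡ 𝟎) × (S ≡ (δ G X △ ∅)))

Feasible : ∀ {t} (G : Graph) → (Fin (nV G) → GF2^ t) → Subset (nE G) → GF2^ t → Set
Feasible G τ Σ α = ∃ λ S → IsSolution G τ Σ α S

IsOptimalValue : ∀ {t} (G : Graph) → (Fin (nV G) → GF2^ t) → Subset (nE G) → GF2^ t
                 → ℕ → Set
IsOptimalValue G τ Σ α k =
  (∃ λ S → IsSolution G τ Σ α S × ∣ S ∣ ≡ k) ×
  (∀ S → IsSolution G τ Σ α S → k Data.Nat.≤ ∣ S ∣)

module Submission where

-- Partition the vertices by their τ-value, splitting on one coordinate of GF(2)^t at a
-- time; within each class pair vertices off, which leaves at most 2^t vertices unpaired,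
-- so there are at least (|V| - 2^t)/2 disjoint pairs {u, v} with τ(u) = τ(v).  Each such
-- pair has τ-sum 0, and when |V| ≥ 3 its cut is non-empty by connectivity, so k ≤ |δ{u,v}|
-- ≤ deg u + deg v.  Summing over the disjoint pairs and using the handshake bound
-- Σ_x deg x ≤ 2(|E| - ℓ), where loops do not count towards degrees, gives the claim.  For
-- |V| = 2 > 2^t we must have t = 0, and a single vertex already has τ-sum 0.

open import Defs
open import Data.Nat using (ℕ; _≤_; _*_; _∸_; _^_)
open import Data.Fin using (Fin)
open import Data.Fin.Subset using (Subset)

open import Algebra.Bundles using (CommutativeMonoid; CommutativeRing)
open import Data.Bool using (Bool; true; false; _xor_; not; if_then_else_)
open import Data.Bool.Properties
  using (xor-identityˡ; xor-identityʳ; xor-same; xor-inverseˡ; ¬-not; xor-∧-commutativeRing)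
  renaming (_≟_ to _≟ᵇ_)
open import Data.Fin using (zero; suc; _≟_)
open import Data.Fin.Subset using (⁅_⁆; ∣_∣; ∁)
open import Data.Fin.Subset.Properties using (x∈⁅x⁆; x≢y⇒x∉⁅y⁆; ∣⁅x⁆∣≡1; ∣∁p∣≡n∸∣p∣; ∣⊥∣≡0)
open import Data.List using (List; []; _∷_; _++_; length; map; allFin)
import Data.List as List
import Data.List.Properties as Listₚ
open import Data.List.Relation.Unary.All as All using (All; []; _∷_)
open import Data.List.Relation.Unary.All.Properties using (++⁺; ++⁻ˡ)
open import Data.List.Relation.Unary.AllPairs using (_∷_)
open import Data.List.Relation.Unary.Unique.Propositional using (Unique)
open import Data.List.Relation.Unary.Unique.Propositional.Properties using (allFin⁺)
open import Data.List.Relation.Binary.Permutation.Propositional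
  using (_↭_; ↭-refl; ↭-sym; ↭-trans; ↭-prep; ↭⇒↭ₛ; module PermutationReasoning)
open import Data.List.Relation.Binary.Permutation.Propositional.Properties
  using (All-resp-↭; shift; shifts; ↭-length; ++⁺ˡ; map⁺)
  renaming (++⁺ to ++⁺-↭)
import Data.List.Relation.Binary.Permutation.Setoid.Properties as Permutationₛ
open import Data.Nat using (zero; suc; _+_; z≤n; s≤s; _<_; _≤?_)
open import Data.Nat.ListAction using (sum)
open import Data.Nat.ListAction.Properties using (sum-++; sum-↭)
open import Data.Nat.Properties
  using (≤-refl; ≤-reflexive; ≤-trans; ≤-pred; ≰⇒>; n≤1+n; m≤m+n; m≤n+m; m≤n⇒m≤n+o;
         m≤n+o⇒m∸n≤o; m≤n⇒m∸n≡0; +-mono-≤; +-monoʳ-≤; *-monoˡ-≤; ∸-mono; +-comm; +-assoc;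
         +-suc; *-identityˡ; *-distribʳ-+; m^n>0; +-0-commutativeMonoid; +-*-semiring;
         module ≤-Reasoning)
open import Algebra.Properties.CommutativeMonoid.Sum +-0-commutativeMonoid
  using (sum-syntax; sum-cong-≗; ∑-comm)
open import Algebra.Properties.Semiring.Sum +-*-semiring using (*-distribˡ-sum)
open import Data.Nat.Tactic.RingSolver using (solve-∀)
open import Data.Product using (_×_; _,_; proj₁; proj₂; ∃; ∃₂; uncurry)
open import Data.Sum using (inj₁; inj₂)
open import Data.Vec using (Vec; []; _∷_; lookup; tabulate; head; tail)
open import Data.Vec.Properties
  using (zipWith-identityˡ; zipWith-identityʳ; lookup-zipWith; lookup-replicate; lookup-map;
         lookup∘tabulate; tabulate∘lookup; tabulate-cong; []=⇒lookup; lookup⇒[]=)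
open import Function using (_∘_; _on_; id)
open import Relation.Binary.Construct.Closure.ReflexiveTransitive using (Star; ε; _◅_)
open import Relation.Binary.PropositionalEquality
open import Relation.Nullary using (¬_; yes; no; contradiction)
open import Relation.Nullary.Decidable using (⌊_⌋)
open import Algebra.Properties.CommutativeSemigroup
  (CommutativeMonoid.commutativeSemigroup (CommutativeRing.+-commutativeMonoid xor-∧-commutativeRing))
  using () renaming (interchange to xor-interchange)

private
  variable
    n t : ℕ
    A : Set

toℕ : Bool → ℕ
toℕ true  = 1
toℕ false = 0

xor-≢ : ∀ {x y} → x ≢ y → x xor y ≡ true
xor-≢ {y = y} x≢y = subst (λ x → x xor y ≡ true) (sym (¬-not x≢y)) (xor-inverseˡ y)

∑-mono-≤ : ∀ {f g : Fin n → ℕ} → (∀ i → f i ≤ g i) → ∑[ i < n ] f i ≤ ∑[ i < n ] g i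
∑-mono-≤ {zero}  f≤g = z≤n
∑-mono-≤ {suc n} f≤g = +-mono-≤ (f≤g zero) (∑-mono-≤ (f≤g ∘ suc))

≤-∑ : ∀ (f : Fin n → ℕ) i → f i ≤ ∑[ j < n ] f j
≤-∑ f zero    = m≤m+n _ _
≤-∑ f (suc i) = ≤-trans (≤-∑ (f ∘ suc) i) (m≤n+m _ _)

sum-map-tabulate : ∀ (f : A → ℕ) (g : Fin n → A) → sum (map f (List.tabulate g)) ≡ ∑[ i < n ] f (g i)
sum-map-tabulate {n = zero}  f g = refl
sum-map-tabulate {n = suc n} f g = cong (f (g zero) +_) (sum-map-tabulate f (g ∘ suc))

sum-map-≤-↭ : ∀ (f : A → ℕ) xs {ys zs} → xs ++ ys ↭ zs → sum (map f xs) ≤ sum (map f zs)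
sum-map-≤-↭ f xs {ys} {zs} xs++ys↭zs = begin
  sum (map f xs)                       ≤⟨ m≤m+n _ _ ⟩
  sum (map f xs) + sum (map f ys)      ≡⟨ sum-++ (map f xs) (map f ys) ⟨
  sum (map f xs ++ map f ys)           ≡⟨ cong sum (Listₚ.map-++ f xs ys) ⟨
  sum (map f (xs ++ ys))               ≡⟨ sum-↭ (map⁺ f xs++ys↭zs) ⟩
  sum (map f zs)                       ∎
  where open ≤-Reasoning

length*≤sum-map : ∀ {k} (f : A → ℕ) {xs} → All (λ x → k ≤ f x) xs → length xs * k ≤ sum (map f xs)
length*≤sum-map f []           = z≤n
length*≤sum-map f (k≤fx ∷ k≤f) = +-mono-≤ k≤fx (length*≤sum-map f k≤f)

++-interchange-↭ : ∀ (as bs cs ds : List A) → (as ++ bs) ++ (cs ++ ds) ↭ (as ++ cs) ++ (bs ++ ds)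
++-interchange-↭ as bs cs ds = begin
  (as ++ bs) ++ (cs ++ ds)  ≡⟨ Listₚ.++-assoc as bs (cs ++ ds) ⟩
  as ++ (bs ++ cs ++ ds)    ↭⟨ ++⁺ˡ as (shifts bs cs) ⟩
  as ++ (cs ++ bs ++ ds)    ≡⟨ Listₚ.++-assoc as cs (bs ++ ds) ⟨
  (as ++ cs) ++ (bs ++ ds)  ∎
  where open PermutationReasoning

∣p∣≡∑ : ∀ (p : Subset n) → ∣ p ∣ ≡ ∑[ i < n ] toℕ (lookup p i)
∣p∣≡∑ []          = refl
∣p∣≡∑ (true ∷ p)  = cong suc (∣p∣≡∑ p)
∣p∣≡∑ (false ∷ p) = ∣p∣≡∑ p

△-identityʳ : ∀ (p : Subset n) → p △ ∅ ≡ p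
△-identityʳ = zipWith-identityʳ xor-identityʳ

△-self : ∀ (p : Subset n) → p △ p ≡ ∅
△-self []      = refl
△-self (x ∷ p) = cong₂ _∷_ (xor-same x) (△-self p)

∣p△q∣≤∣p∣+∣q∣ : ∀ (p q : Subset n) → ∣ p △ q ∣ ≤ ∣ p ∣ + ∣ q ∣
∣p△q∣≤∣p∣+∣q∣ []          []          = z≤n
∣p△q∣≤∣p∣+∣q∣ (true ∷ p)  (true ∷ q)  = ≤-trans (∣p△q∣≤∣p∣+∣q∣ p q) (+-mono-≤ (n≤1+n _) (n≤1+n _))
∣p△q∣≤∣p∣+∣q∣ (true ∷ p)  (false ∷ q) = s≤s (∣p△q∣≤∣p∣+∣q∣ p q)
∣p△q∣≤∣p∣+∣q∣ (false ∷ p) (true ∷ q)  = ≤-trans (s≤s (∣p△q∣≤∣p∣+∣q∣ p q)) (≤-reflexive (sym (+-suc ∣ p ∣ ∣ q ∣)))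
∣p△q∣≤∣p∣+∣q∣ (false ∷ p) (false ∷ q) = ∣p△q∣≤∣p∣+∣q∣ p q

⁅⁆-sym : ∀ (x y : Fin n) → lookup ⁅ x ⁆ y ≡ lookup ⁅ y ⁆ x
⁅⁆-sym zero    zero    = refl
⁅⁆-sym zero    (suc y) = lookup-replicate y false
⁅⁆-sym (suc x) zero    = sym (lookup-replicate x false)
⁅⁆-sym (suc x) (suc y) = ⁅⁆-sym x y

lookup-⁅x⁆-x : ∀ (x : Fin n) → lookup ⁅ x ⁆ x ≡ true
lookup-⁅x⁆-x x = []=⇒lookup (x∈⁅x⁆ x)

lookup-⁅y⁆-x : ∀ {x y : Fin n} → x ≢ y → lookup ⁅ y ⁆ x ≡ false
lookup-⁅y⁆-x {x = x} {y} x≢y = ¬-not (x≢y⇒x∉⁅y⁆ x≢y ∘ lookup⇒[]= x ⁅ y ⁆)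

∣⁅x⁆△⁅y⁆∣≤ : ∀ (x y : Fin n) → ∣ ⁅ x ⁆ △ ⁅ y ⁆ ∣ ≤ 2 * toℕ (not ⌊ x ≟ y ⌋)
∣⁅x⁆△⁅y⁆∣≤ {n} x y with x ≟ y
... | yes refl = ≤-reflexive (trans (cong ∣_∣ (△-self ⁅ x ⁆)) (∣⊥∣≡0 n))
... | no  _    = ≤-trans (∣p△q∣≤∣p∣+∣q∣ ⁅ x ⁆ ⁅ y ⁆) (≤-reflexive (cong₂ _+_ (∣⁅x⁆∣≡1 x) (∣⁅x⁆∣≡1 y)))

separates : ∀ {X : Subset n} {x y} → lookup X x ≡ true → lookup X y ≡ false → lookup X x ≢ lookup X y
separates x∈X y∉X x≈y = contradiction (trans (sym x∈X) (trans x≈y y∉X)) λ ()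

two-vertices : 2 ≤ n → ∃₂ λ (x y : Fin n) → x ≢ y
two-vertices (s≤s (s≤s _)) = zero , suc zero , λ ()

third-vertex : 3 ≤ n → ∀ (u v : Fin n) → ∃ λ w → w ≢ u × w ≢ v
third-vertex (s≤s (s≤s (s≤s _))) zero          zero          = suc zero , (λ ()) , (λ ())
third-vertex (s≤s (s≤s (s≤s _))) zero          (suc zero)    = suc (suc zero) , (λ ()) , (λ ())
third-vertex (s≤s (s≤s (s≤s _))) zero          (suc (suc _)) = suc zero , (λ ()) , (λ ())
third-vertex (s≤s (s≤s (s≤s _))) (suc zero)    zero          = suc (suc zero) , (λ ()) , (λ ())
third-vertex (s≤s (s≤s (s≤s _))) (suc zero)    (suc _)       = zero , (λ ()) , (λ ())
third-vertex (s≤s (s≤s (s≤s _))) (suc (suc _)) zero          = suc zero , (λ ()) , (λ ())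
third-vertex (s≤s (s≤s (s≤s _))) (suc (suc _)) (suc _)       = zero , (λ ()) , (λ ())

⊕-identityˡ : ∀ (x : GF2^ t) → 𝟎 ⊕ x ≡ x
⊕-identityˡ = zipWith-identityˡ xor-identityˡ

⊕-identityʳ : ∀ (x : GF2^ t) → x ⊕ 𝟎 ≡ x
⊕-identityʳ = zipWith-identityʳ xor-identityʳ

⊕-self : ∀ (x : GF2^ t) → x ⊕ x ≡ 𝟎
⊕-self = △-self

⊕-interchange : ∀ (a b c d : GF2^ t) → (a ⊕ b) ⊕ (c ⊕ d) ≡ (a ⊕ c) ⊕ (b ⊕ d)
⊕-interchange []      []      []      []      = refl
⊕-interchange (a ∷ w) (b ∷ x) (c ∷ y) (d ∷ z) =
  cong₂ _∷_ (xor-interchange a b c d) (⊕-interchange w x y z)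

Vec₀-≡ : ∀ (xs ys : Vec A 0) → xs ≡ ys
Vec₀-≡ [] [] = refl

GF2^-trivial : 2 ^ t ≤ 1 → ∀ (x : GF2^ t) → x ≡ 𝟎
GF2^-trivial {zero}  _          x = Vec₀-≡ x 𝟎
GF2^-trivial {suc t} 2^t+2^t≤1 _ =
  contradiction (≤-trans (+-mono-≤ (m^n>0 2 t) (m≤n⇒m≤n+o 0 (m^n>0 2 t))) 2^t+2^t≤1) λ { (s≤s ()) }

if-xor : ∀ (x y : Bool) (a : GF2^ t) →
         (if x xor y then a else 𝟎) ≡ (if x then a else 𝟎) ⊕ (if y then a else 𝟎)
if-xor true  true  a = sym (⊕-self a)
if-xor true  false a = sym (⊕-identityʳ a)
if-xor false true  a = sym (⊕-identityˡ a)
if-xor false false a = sym (⊕-identityˡ 𝟎)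

τsum-∅ : ∀ (τ : Fin n → GF2^ t) → τsum τ ∅ ≡ 𝟎
τsum-∅ {zero}  τ = refl
τsum-∅ {suc n} τ = trans (⊕-identityˡ _) (τsum-∅ (τ ∘ suc))

τsum-△ : ∀ (τ : Fin n → GF2^ t) X Y → τsum τ (X △ Y) ≡ τsum τ X ⊕ τsum τ Y
τsum-△ τ []      []      = sym (⊕-identityˡ 𝟎)
τsum-△ τ (x ∷ X) (y ∷ Y) = begin
  (if x xor y then τ zero else 𝟎) ⊕ τsum (τ ∘ suc) (X △ Y)
    ≡⟨ cong₂ _⊕_ (if-xor x y (τ zero)) (τsum-△ (τ ∘ suc) X Y) ⟩
  ((if x then τ zero else 𝟎) ⊕ (if y then τ zero else 𝟎)) ⊕ (τsum (τ ∘ suc) X ⊕ τsum (τ ∘ suc) Y)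
    ≡⟨ ⊕-interchange _ _ _ _ ⟩
  τsum τ (x ∷ X) ⊕ τsum τ (y ∷ Y) ∎
  where open ≡-Reasoning

τsum-⁅⁆ : ∀ (τ : Fin n → GF2^ t) x → τsum τ ⁅ x ⁆ ≡ τ x
τsum-⁅⁆ τ zero    = trans (cong (τ zero ⊕_) (τsum-∅ (τ ∘ suc))) (⊕-identityʳ (τ zero))
τsum-⁅⁆ τ (suc x) = trans (⊕-identityˡ _) (τsum-⁅⁆ (τ ∘ suc) x)

τsum-pair : ∀ (τ : Fin n → GF2^ t) {x y} → τ x ≡ τ y → τsum τ (⁅ x ⁆ △ ⁅ y ⁆) ≡ 𝟎
τsum-pair τ {x} {y} τx≡τy = begin
  τsum τ (⁅ x ⁆ △ ⁅ y ⁆)      ≡⟨ τsum-△ τ ⁅ x ⁆ ⁅ y ⁆ ⟩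
  τsum τ ⁅ x ⁆ ⊕ τsum τ ⁅ y ⁆ ≡⟨ cong₂ _⊕_ (τsum-⁅⁆ τ x) (trans (τsum-⁅⁆ τ y) (sym τx≡τy)) ⟩
  τ x ⊕ τ x                   ≡⟨ ⊕-self (τ x) ⟩
  𝟎                           ∎
  where open ≡-Reasoning

endpoints : List (A × A) → List A
endpoints []            = []
endpoints ((u , v) ∷ P) = u ∷ v ∷ endpoints P

endpoints-++ : ∀ (P Q : List (A × A)) → endpoints (P ++ Q) ≡ endpoints P ++ endpoints Q
endpoints-++ []            Q = refl
endpoints-++ ((u , v) ∷ P) Q = cong (λ E → u ∷ v ∷ E) (endpoints-++ P Q)

length-endpoints : ∀ (P : List (A × A)) → length (endpoints P) ≡ length P + length P
length-endpoints []      = refl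
length-endpoints (_ ∷ P) = cong suc (trans (cong suc (length-endpoints P)) (sym (+-suc _ _)))

sum-map-endpoints : ∀ (f : A → ℕ) P →
                    sum (map f (endpoints P)) ≡ sum (map (λ p → f (proj₁ p) + f (proj₂ p)) P)
sum-map-endpoints f []            = refl
sum-map-endpoints f ((u , v) ∷ P) =
  trans (cong (λ s → f u + (f v + s)) (sum-map-endpoints f P)) (sym (+-assoc (f u) (f v) _))

All-endpoints⁻ : ∀ {Q : A → Set} P → All Q (endpoints P) → All (λ p → Q (proj₁ p) × Q (proj₂ p)) P
All-endpoints⁻ []            []              = []
All-endpoints⁻ ((u , v) ∷ P) (Qu ∷ Qv ∷ Q[P]) = (Qu , Qv) ∷ All-endpoints⁻ P Q[P]

Unique-endpoints⇒distinct : ∀ (P : List (A × A)) {R} → Unique (endpoints P ++ R) → All (uncurry _≢_) P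
Unique-endpoints⇒distinct []            _                       = []
Unique-endpoints⇒distinct ((u , v) ∷ P) ((u≢v ∷ _) ∷ _ ∷ unique) = u≢v ∷ Unique-endpoints⇒distinct P unique

partitionᵇ : ∀ (h : A → Bool) L →
             ∃₂ λ L₀ L₁ → All (λ x → h x ≡ false) L₀ × All (λ x → h x ≡ true) L₁ × L₀ ++ L₁ ↭ L
partitionᵇ h [] = [] , [] , [] , [] , ↭-refl
partitionᵇ h (x ∷ L) with partitionᵇ h L | h x in hx
... | L₀ , L₁ , false₀ , true₁ , L₀++L₁↭L | false = x ∷ L₀ , L₁ , hx ∷ false₀ , true₁ , ↭-prep x L₀++L₁↭L
... | L₀ , L₁ , false₀ , true₁ , L₀++L₁↭L | true  =
  L₀ , x ∷ L₁ , false₀ , hx ∷ true₁ , ↭-trans (shift x L₀ L₁) (↭-prep x L₀++L₁↭L)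

head-tail-≡ : ∀ {xs ys : Vec A (suc n)} → head xs ≡ head ys → tail xs ≡ tail ys → xs ≡ ys
head-tail-≡ {xs = _ ∷ _} {_ ∷ _} = cong₂ _∷_

twins-by-head : ∀ {b} (σ : A → Vec Bool (suc t)) P {R L} →
                All (λ x → head (σ x) ≡ b) L → endpoints P ++ R ↭ L →
                All (uncurry (_≡_ on (tail ∘ σ))) P → All (uncurry (_≡_ on σ)) P
twins-by-head σ P heads E++R↭L twins = All.zipWith
  (λ { ((hu , hv) , tu≡tv) → head-tail-≡ (trans hu (sym hv)) tu≡tv })
  (All-endpoints⁻ P (++⁻ˡ (endpoints P) (All-resp-↭ (↭-sym E++R↭L) heads)) , twins)

pairUp : ∀ t (σ : A → Vec Bool t) L →
         ∃₂ λ P R → All (uncurry (_≡_ on σ)) P × endpoints P ++ R ↭ L × length R ≤ 2 ^ t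
pairUp zero σ [] = [] , [] , [] , ↭-refl , z≤n
pairUp zero σ (x ∷ []) = [] , x ∷ [] , [] , ↭-refl , ≤-refl
pairUp zero σ (x ∷ y ∷ L) with pairUp zero σ L
... | P , R , twins , E++R↭L , R≤1 =
  (x , y) ∷ P , R , Vec₀-≡ (σ x) (σ y) ∷ twins , ↭-prep x (↭-prep y E++R↭L) , R≤1
pairUp (suc t) σ L with partitionᵇ (head ∘ σ) L
... | L₀ , L₁ , false₀ , true₁ , L₀++L₁↭L
    with pairUp t (tail ∘ σ) L₀ | pairUp t (tail ∘ σ) L₁
... | P₀ , R₀ , twins₀ , E₀++R₀↭L₀ , R₀≤ | P₁ , R₁ , twins₁ , E₁++R₁↭L₁ , R₁≤ =
  P₀ ++ P₁ , R₀ ++ R₁ ,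
  ++⁺ (twins-by-head σ P₀ false₀ E₀++R₀↭L₀ twins₀) (twins-by-head σ P₁ true₁ E₁++R₁↭L₁ twins₁) ,
  E++R↭L ,
  ≤-trans (≤-reflexive (Listₚ.length-++ R₀)) (+-mono-≤ R₀≤ (m≤n⇒m≤n+o 0 R₁≤))
  where
  E++R↭L : endpoints (P₀ ++ P₁) ++ (R₀ ++ R₁) ↭ L
  E++R↭L = begin
    endpoints (P₀ ++ P₁) ++ (R₀ ++ R₁)                 ≡⟨ cong (_++ (R₀ ++ R₁)) (endpoints-++ P₀ P₁) ⟩
    (endpoints P₀ ++ endpoints P₁) ++ (R₀ ++ R₁)       ↭⟨ ++-interchange-↭ (endpoints P₀) (endpoints P₁) R₀ R₁ ⟩
    (endpoints P₀ ++ R₀) ++ (endpoints P₁ ++ R₁)       ↭⟨ ++⁺-↭ E₀++R₀↭L₀ E₁++R₁↭L₁ ⟩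
    L₀ ++ L₁                                           ↭⟨ L₀++L₁↭L ⟩
    L                                                  ∎
    where open PermutationReasoning

module _ (G : Graph) where

  crosses : Subset (nV G) → Fin (nV G) × Fin (nV G) → Bool
  crosses X (a , b) = lookup X a xor lookup X b

  lookup-δ : ∀ X e → lookup (δ G X) e ≡ crosses X (ends G e)
  lookup-δ X e = lookup∘tabulate _ e

  δ-△ : ∀ X Y → δ G (X △ Y) ≡ δ G X △ δ G Y
  δ-△ X Y = trans (tabulate-cong crosses-△) (tabulate∘lookup (δ G X △ δ G Y))
    where
    open ≡-Reasoning
    crosses-△ : ∀ e → crosses (X △ Y) (ends G e) ≡ lookup (δ G X △ δ G Y) e
    crosses-△ e = begin
      lookup (X △ Y) a xor lookup (X △ Y) b
        ≡⟨ cong₂ _xor_ (lookup-zipWith _xor_ a X Y) (lookup-zipWith _xor_ b X Y) ⟩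
      (lookup X a xor lookup Y a) xor (lookup X b xor lookup Y b)
        ≡⟨ xor-interchange (lookup X a) (lookup Y a) (lookup X b) (lookup Y b) ⟩
      crosses X (ends G e) xor crosses Y (ends G e)
        ≡⟨ cong₂ _xor_ (lookup-δ X e) (lookup-δ Y e) ⟨
      lookup (δ G X) e xor lookup (δ G Y) e
        ≡⟨ lookup-zipWith _xor_ e (δ G X) (δ G Y) ⟨
      lookup (δ G X △ δ G Y) e ∎
      where
      a = proj₁ (ends G e)
      b = proj₂ (ends G e)

  ∣δ[X△Y]∣≤∣δX∣+∣δY∣ : ∀ X Y → ∣ δ G (X △ Y) ∣ ≤ ∣ δ G X ∣ + ∣ δ G Y ∣
  ∣δ[X△Y]∣≤∣δX∣+∣δY∣ X Y rewrite δ-△ X Y = ∣p△q∣≤∣p∣+∣q∣ (δ G X) (δ G Y)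

  δ-nonempty : ∀ X {x y} → Star (Adj G) x y → lookup X x ≢ lookup X y → NonEmpty (δ G X)
  δ-nonempty X ε x≁y = contradiction refl x≁y
  δ-nonempty X {x} (_◅_ {j = z} x~z z⋯y) x≁y with lookup X x ≟ᵇ lookup X z
  ... | yes x≈z = δ-nonempty X z⋯y (x≁y ∘ trans x≈z)
  ... | no  x≁z = crossing x~z
    where
    crossing : Adj G x z → NonEmpty (δ G X)
    crossing (e , inj₁ ends≡xz) = e , trans (lookup-δ X e) (trans (cong (crosses X) ends≡xz) (xor-≢ x≁z))
    crossing (e , inj₂ ends≡zx) = e , trans (lookup-δ X e) (trans (cong (crosses X) ends≡zx) (xor-≢ (x≁z ∘ sym)))

  degree : Fin (nV G) → ℕ
  degree x = ∣ δ G ⁅ x ⁆ ∣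

  Loops : Subset (nE G)
  Loops = tabulate (λ e → ⌊ proj₁ (ends G e) ≟ proj₂ (ends G e) ⌋)

  ∑[e∈δ⁅x⁆]≤ : ∀ e → ∑[ x < nV G ] toℕ (lookup (δ G ⁅ x ⁆) e) ≤ 2 * toℕ (lookup (∁ Loops) e)
  ∑[e∈δ⁅x⁆]≤ e = begin
    ∑[ x < nV G ] toℕ (lookup (δ G ⁅ x ⁆) e)     ≡⟨ sum-cong-≗ (cong toℕ ∘ lookup-δ⁅⁆) ⟩
    ∑[ x < nV G ] toℕ (lookup (⁅ a ⁆ △ ⁅ b ⁆) x) ≡⟨ ∣p∣≡∑ (⁅ a ⁆ △ ⁅ b ⁆) ⟨
    ∣ ⁅ a ⁆ △ ⁅ b ⁆ ∣                            ≤⟨ ∣⁅x⁆△⁅y⁆∣≤ a b ⟩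
    2 * toℕ (not ⌊ a ≟ b ⌋)                      ≡⟨ cong (λ c → 2 * toℕ c) lookup-∁Loops ⟨
    2 * toℕ (lookup (∁ Loops) e)                  ∎
    where
    open ≤-Reasoning
    a = proj₁ (ends G e)
    b = proj₂ (ends G e)
    lookup-δ⁅⁆ : ∀ x → lookup (δ G ⁅ x ⁆) e ≡ lookup (⁅ a ⁆ △ ⁅ b ⁆) x
    lookup-δ⁅⁆ x = trans (lookup-δ ⁅ x ⁆ e)
      (trans (cong₂ _xor_ (⁅⁆-sym x a) (⁅⁆-sym x b)) (sym (lookup-zipWith _xor_ x ⁅ a ⁆ ⁅ b ⁆)))
    lookup-∁Loops : lookup (∁ Loops) e ≡ not ⌊ a ≟ b ⌋
    lookup-∁Loops = trans (lookup-map e not Loops) (cong not (lookup∘tabulate _ e))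

  handshake-≤ : ∑[ x < nV G ] degree x ≤ 2 * (nE G ∸ loops G)
  handshake-≤ = begin
    ∑[ x < nV G ] degree x                                    ≡⟨ sum-cong-≗ (∣p∣≡∑ ∘ δ G ∘ ⁅_⁆) ⟩
    ∑[ x < nV G ] ∑[ e < nE G ] toℕ (lookup (δ G ⁅ x ⁆) e)    ≡⟨ ∑-comm (λ x e → toℕ (lookup (δ G ⁅ x ⁆) e)) ⟩
    ∑[ e < nE G ] ∑[ x < nV G ] toℕ (lookup (δ G ⁅ x ⁆) e)    ≤⟨ ∑-mono-≤ ∑[e∈δ⁅x⁆]≤ ⟩
    ∑[ e < nE G ] (2 * toℕ (lookup (∁ Loops) e))              ≡⟨ *-distribˡ-sum 2 (toℕ ∘ lookup (∁ Loops)) ⟨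
    2 * ∑[ e < nE G ] toℕ (lookup (∁ Loops) e)                ≡⟨ cong (2 *_) (∣p∣≡∑ (∁ Loops)) ⟨
    2 * ∣ ∁ Loops ∣                                           ≡⟨ cong (2 *_) (∣∁p∣≡n∸∣p∣ Loops) ⟩
    2 * (nE G ∸ loops G)                                      ∎
    where open ≤-Reasoning

module _ {t} (G : Graph) (τ : Fin (nV G) → GF2^ t) (Σ : Subset (nE G)) (α : GF2^ t) {k : ℕ}
         (connected : Connected G) (optimal : ∀ S → IsSolution G τ Σ α S → k ≤ ∣ S ∣) where

  k≤∣δ∣ : ∀ X {x y} → τsum τ X ≡ 𝟎 → lookup X x ≢ lookup X y → k ≤ ∣ δ G X ∣
  k≤∣δ∣ X {x} {y} τX≡𝟎 x≁y =
    subst (λ S → k ≤ ∣ S ∣) (△-identityʳ (δ G X)) (optimal (δ G X △ ∅) (nonempty , X , inj₂ (τX≡𝟎 , refl)))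
    where
    nonempty : NonEmpty (δ G X △ ∅)
    nonempty = subst NonEmpty (sym (△-identityʳ (δ G X))) (δ-nonempty G X (connected x y) x≁y)

  k≤degree+degree : 3 ≤ nV G → ∀ p → uncurry (_≡_ on τ) p × uncurry _≢_ p →
                    k ≤ degree G (proj₁ p) + degree G (proj₂ p)
  k≤degree+degree 3≤n (u , v) (τu≡τv , u≢v) with third-vertex 3≤n u v
  ... | w , w≢u , w≢v =
    ≤-trans (k≤∣δ∣ (⁅ u ⁆ △ ⁅ v ⁆) (τsum-pair τ τu≡τv) (separates {X = ⁅ u ⁆ △ ⁅ v ⁆} u∈ w∉))
            (∣δ[X△Y]∣≤∣δX∣+∣δY∣ G ⁅ u ⁆ ⁅ v ⁆)
    where
    u∈ : lookup (⁅ u ⁆ △ ⁅ v ⁆) u ≡ true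
    u∈ = trans (lookup-zipWith _xor_ u ⁅ u ⁆ ⁅ v ⁆) (cong₂ _xor_ (lookup-⁅x⁆-x u) (lookup-⁅y⁆-x u≢v))
    w∉ : lookup (⁅ u ⁆ △ ⁅ v ⁆) w ≡ false
    w∉ = trans (lookup-zipWith _xor_ w ⁅ u ⁆ ⁅ v ⁆) (cong₂ _xor_ (lookup-⁅y⁆-x w≢u) (lookup-⁅y⁆-x w≢v))

  pairs-bound : 3 ≤ nV G → (nV G ∸ 2 ^ t) * k ≤ 4 * (nE G ∸ loops G)
  pairs-bound 3≤n with pairUp t τ (allFin (nV G))
  ... | P , R , twins , E++R↭V , R≤2^t = begin
    (nV G ∸ 2 ^ t) * k                              ≤⟨ *-monoˡ-≤ k n∸2^t≤2∣P∣ ⟩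
    (length P + length P) * k                       ≡⟨ *-distribʳ-+ k (length P) (length P) ⟩
    length P * k + length P * k                     ≤⟨ +-mono-≤ ∣P∣k≤2m′ ∣P∣k≤2m′ ⟩
    2 * (nE G ∸ loops G) + 2 * (nE G ∸ loops G)     ≡⟨ 2*m+2*m≡4*m (nE G ∸ loops G) ⟩
    4 * (nE G ∸ loops G)                            ∎
    where
    open ≤-Reasoning
    2*m+2*m≡4*m : ∀ m → 2 * m + 2 * m ≡ 4 * m
    2*m+2*m≡4*m = solve-∀
    n∸2^t≤2∣P∣ : nV G ∸ 2 ^ t ≤ length P + length P
    n∸2^t≤2∣P∣ = m≤n+o⇒m∸n≤o (nV G) (2 ^ t) (begin
      nV G                                ≡⟨ Listₚ.length-tabulate id ⟨
      length (allFin (nV G))              ≡⟨ ↭-length E++R↭V ⟨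
      length (endpoints P ++ R)           ≡⟨ Listₚ.length-++ (endpoints P) ⟩
      length (endpoints P) + length R     ≤⟨ +-monoʳ-≤ (length (endpoints P)) R≤2^t ⟩
      length (endpoints P) + 2 ^ t        ≡⟨ +-comm (length (endpoints P)) (2 ^ t) ⟩
      2 ^ t + length (endpoints P)        ≡⟨ cong (2 ^ t +_) (length-endpoints P) ⟩
      2 ^ t + (length P + length P)       ∎)
    distinct : All (uncurry _≢_) P
    distinct = Unique-endpoints⇒distinct P
      (Permutationₛ.Unique-resp-↭ (setoid (Fin (nV G))) (↭⇒↭ₛ (↭-sym E++R↭V)) (allFin⁺ (nV G)))
    ∣P∣k≤2m′ : length P * k ≤ 2 * (nE G ∸ loops G)
    ∣P∣k≤2m′ = begin
      length P * k
        ≤⟨ length*≤sum-map _ (All.zipWith (k≤degree+degree 3≤n _) (twins , distinct)) ⟩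
      sum (map (λ p → degree G (proj₁ p) + degree G (proj₂ p)) P)
        ≡⟨ sum-map-endpoints (degree G) P ⟨
      sum (map (degree G) (endpoints P))        ≤⟨ sum-map-≤-↭ (degree G) (endpoints P) E++R↭V ⟩
      sum (map (degree G) (allFin (nV G)))      ≡⟨ sum-map-tabulate (degree G) id ⟩
      ∑[ x < nV G ] degree G x                  ≤⟨ handshake-≤ G ⟩
      2 * (nE G ∸ loops G)                      ∎

  two-vertex-bound : ¬ nV G ≤ 2 ^ t → ¬ 3 ≤ nV G → (nV G ∸ 2 ^ t) * k ≤ 4 * (nE G ∸ loops G)
  two-vertex-bound n≰2^t 3≰n with two-vertices (≤-trans (s≤s (m^n>0 2 t)) (≰⇒> n≰2^t))
  ... | x , y , x≢y = begin
    (nV G ∸ 2 ^ t) * k        ≤⟨ *-monoˡ-≤ k (∸-mono n≤2 (m^n>0 2 t)) ⟩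
    1 * k                     ≡⟨ *-identityˡ k ⟩
    k                         ≤⟨ k≤∣δ∣ ⁅ x ⁆ τ⁅x⁆≡𝟎 (separates {X = ⁅ x ⁆} (lookup-⁅x⁆-x x) (lookup-⁅y⁆-x (x≢y ∘ sym))) ⟩
    degree G x                ≤⟨ ≤-∑ (degree G) x ⟩
    ∑[ v < nV G ] degree G v  ≤⟨ handshake-≤ G ⟩
    2 * (nE G ∸ loops G)      ≤⟨ *-monoˡ-≤ (nE G ∸ loops G) (m≤m+n 2 2) ⟩
    4 * (nE G ∸ loops G)      ∎
    where
    open ≤-Reasoning
    n≤2 : nV G ≤ 2
    n≤2 = ≤-pred (≰⇒> 3≰n)
    τ⁅x⁆≡𝟎 : τsum τ ⁅ x ⁆ ≡ 𝟎
    τ⁅x⁆≡𝟎 = trans (τsum-⁅⁆ τ x) (GF2^-trivial (≤-pred (≤-trans (≰⇒> n≰2^t) n≤2)) (τ x))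

lemma3p6 : (t : ℕ) (G : Graph) (τ : Fin (nV G) → GF2^ t) (Σ : Subset (nE G))
           (α : GF2^ t) (k : ℕ) →
           Connected G → Feasible G τ Σ α → IsOptimalValue G τ Σ α k →
           (nV G ∸ 2 ^ t) * k ≤ 4 * (nE G ∸ loops G)
lemma3p6 t G τ Σ α k connected _ (_ , optimal) with nV G ≤? 2 ^ t | 3 ≤? nV G
... | yes n≤2^t | _       = ≤-trans (≤-reflexive (cong (_* k) (m≤n⇒m∸n≡0 n≤2^t))) z≤n
... | no  _     | yes 3≤n = pairs-bound G τ Σ α connected optimal 3≤n
... | no  n≰2^t | no  3≰n = two-vertex-bound G τ Σ α connected optimal n≰2^t 3≰n
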